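{- Let $G$ be a unicyclic graph with unique cycle $C$. If there exists some $x\in N_1(C)$ such that $x\in\mathrm{core}(T_x)$, then $G$ is a König–Egerváry graph.
   Context: All graphs are finite, simple and undirected. A graph is unicyclic if it is connected and contains exactly one cycle. $\alpha(G)$ is the maximum cardinality of an independent set (a set of pairwise non-adjacent vertices) of $G$, and $\mu(G)$ is the maximum cardinality of a matching of $G$. A graph $G$ on $n$ vertices is a König–Egerváry graph if $\alpha(G)+\mu(G)=n$. $\mathrm{core}(H)$ is the intersection of all maximum independent sets of a graph $H$. For the unique cycle $C$ of $G$, $N_1(C)=\{v\in V(G)\setminus V(C): v \text{ has a neighbor in } V(C)\}$. For $x\in N_1(C)$ with neighbor $y\in V(C)$, $T_x$ denotes the tree which is the connected component containing $x$ of the graph $G-xy$ obtained by deleting the edge $xy$. -}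

module Defs where

open import Data.Nat using (ℕ; zero; suc; _+_; _≤_)
open import Data.Fin using (Fin; zero; suc)
open import Data.Fin.Subset using (Subset; _∈_; _∉_; ∣_∣)
open import Data.Bool using (Bool; true; false)
open import Data.Product using (Σ; ∃; ∃-syntax; _×_; _,_; proj₁; proj₂)
open import Data.Sum using (_⊎_)
open import Relation.Nullary using (¬_)
open import Relation.Binary.PropositionalEquality using (_≡_; _≢_)
open import Relation.Binary.Construct.Closure.ReflexiveTransitive using (Star)
open import Function.Definitions using (Injective)
open import Function.Bundles using (_⇔_)

record Graph : Set where
  field
    n      : ℕ
    adj    : Fin n → Fin n → Bool
    sym    : ∀ u v → adj u v ≡ adj v u
    irrefl : ∀ v → adj v v ≡ false

open Graph public

Adj : (G : Graph) → Fin (n G) → Fin (n G) → Set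
Adj G u v = adj G u v ≡ true

Connected : Graph → Set
Connected G = ∀ u v → Star (Adj G) u v

sucMod : ∀ {m} → Fin (suc m) → Fin (suc m)
sucMod {zero} zero = zero
sucMod {suc m} zero = suc zero
sucMod {suc m} (suc i) with sucMod {m} i
... | zero = zero
... | suc j = suc (suc j)

record Cycle (G : Graph) : Set where
  field
    k     : ℕ
    vtx   : Fin (3 + k) → Fin (n G)
    inj   : Injective _≡_ _≡_ vtx
    edges : ∀ i → Adj G (vtx i) (vtx (sucMod i))

open Cycle public

OnCycle : {G : Graph} → Cycle G → Fin (n G) → Set
OnCycle C u = ∃[ i ] vtx C i ≡ u

CycleEdge : {G : Graph} → Cycle G → Fin (n G) → Fin (n G) → Set
CycleEdge C u w = ∃[ i ] ((vtx C i ≡ u × vtx C (sucMod i) ≡ w)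
                         ⊎ (vtx C i ≡ w × vtx C (sucMod i) ≡ u))

-- Two cycles are the same cycle (subgraph) iff they have the same edge set.
SameCycle : {G : Graph} → Cycle G → Cycle G → Set
SameCycle C D = ∀ u w → CycleEdge C u w ⇔ CycleEdge D u w

UnicyclicWith : (G : Graph) → Cycle G → Set
UnicyclicWith G C = Connected G × (∀ (D : Cycle G) → SameCycle C D)

Independent : (G : Graph) → Subset (n G) → Set
Independent G S = ∀ u v → u ∈ S → v ∈ S → ¬ Adj G u v

record Matching (G : Graph) (m : ℕ) : Set where
  field
    a b      : Fin m → Fin (n G)
    isEdge   : ∀ i → Adj G (a i) (b i)
    disjoint : ∀ i j → i ≢ j →
               (a i ≢ a j) × (a i ≢ b j) × (b i ≢ a j) × (b i ≢ b j)

IsIndependenceNumber : (G : Graph) → ℕ → Set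
IsIndependenceNumber G k =
  (∃[ S ] (Independent G S × ∣ S ∣ ≡ k)) ×
  (∀ S → Independent G S → ∣ S ∣ ≤ k)

IsMatchingNumber : (G : Graph) → ℕ → Set
IsMatchingNumber G k = Matching G k × (∀ m → Matching G m → m ≤ k)

KonigEgervary : Graph → Set
KonigEgervary G = ∃[ a ] ∃[ m ]
  (IsIndependenceNumber G a × IsMatchingNumber G m × a + m ≡ n G)

AdjDel : (G : Graph) → Fin (n G) → Fin (n G) → Fin (n G) → Fin (n G) → Set
AdjDel G x y u v =
  Adj G u v × ¬ ((u ≡ x × v ≡ y) ⊎ (u ≡ y × v ≡ x))

-- vertices of T_x: the component of G - xy containing x
InTx : (G : Graph) → Fin (n G) → Fin (n G) → Fin (n G) → Set
InTx G x y v = Star (AdjDel G x y) x v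

IndependentTx : (G : Graph) → Fin (n G) → Fin (n G) → Subset (n G) → Set
IndependentTx G x y S =
  (∀ v → v ∈ S → InTx G x y v) ×
  (∀ u v → u ∈ S → v ∈ S → ¬ AdjDel G x y u v)

MaxIndependentTx : (G : Graph) → Fin (n G) → Fin (n G) → Subset (n G) → Set
MaxIndependentTx G x y S =
  IndependentTx G x y S × (∀ S' → IndependentTx G x y S' → ∣ S' ∣ ≤ ∣ S ∣)

InCoreTx : (G : Graph) → Fin (n G) → Fin (n G) → Fin (n G) → Set
InCoreTx G x y v = ∀ S → MaxIndependentTx G x y S → v ∈ S

module Submission where

-- A König decomposition of a vertex set A is an independent set S ⊆ A with a
-- matching that pairs every vertex of A ∖ S with its own partner in S.  As
-- |S| + |M| ≤ n for every independent set S and matching M, a decomposition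
-- of all of V(G) certifies that G is König–Egerváry.
--
-- Every cycle of G runs through y, so G - y is a forest.  Peeling off isolated
-- vertices, and leaves together with their neighbours, decomposes any forest;
-- starting each peeling at x ensures that x is never the S-end of a matched
-- edge.  The component T_x of x in G - xy avoids y, and the S-part of a
-- decomposition of G - y is a maximum independent set of it, so x ∈ core(T_x)
-- puts x into S; matching x with y then decomposes all of V(G).

open import Defs hiding (sym; k)
open import Data.Nat using (ℕ; zero; suc; _+_; _≤_; _<_; z≤n; s≤s)
open import Data.Nat.Properties
  using (≤-trans; ≤-reflexive; ≤-antisym; ≤-<-trans; <⇒≱; +-cancelʳ-≤; +-cancelˡ-≤; +-comm; +-suc; +-identityʳ; m≤n+m)
open import Data.Fin using (Fin; zero; suc; toℕ; fromℕ<)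
open import Data.Fin.Properties using (suc-injective; toℕ-injective; toℕ<n; toℕ-fromℕ<; any?) renaming (_≟_ to _≟ᶠ_)
open import Data.Fin.Subset using (Subset; inside; outside; _∈_; _∉_; _⊆_; _⊂_; ∣_∣; ⊤; _∪_; _∩_; _─_; _-_; ⁅_⁆; Nonempty)
open import Data.Fin.Subset.Properties
  using (_∈?_; ∈⊤; ∣⊤∣≡n; ∣p∣≤n; p⊂q⇒∣p∣<∣q∣; ⊆-antisym; ⊆-⊂-trans; nonempty?; x∈⁅x⁆; x∈⁅y⁆⇒x≡y;
         x∈p∪q⁺; x∈p∪q⁻; x∈p∩q⁺; x∈p∩q⁻; p─q⊆p; x∈p∧x≢y⇒x∈p-y; x∈p⇒p-x⊂p)
open import Data.Fin.Subset.Induction using (Acc; acc; ⊂-wellFounded)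
open import Data.Bool using (true) renaming (_≟_ to _≟ᵇ_)
open import Data.Vec.Base using (_∷_; []; tabulate; module _[_]=_)
open _[_]=_ renaming (here to hereₛ; there to thereₛ)
open import Data.Vec.Properties using (lookup∘tabulate; []=⇒lookup; lookup⇒[]=)
open import Data.List.Base using (List; []; _∷_; _++_; [_]; length; map; allFin)
open import Data.List.Properties using (length-++; length-map; length-tabulate; length-removeAt′; ++-assoc)
open import Data.List.Relation.Unary.Any using (here; there) renaming (_─_ to _─ₗ_)
open import Data.List.Relation.Unary.All as All using (All; []; _∷_)
open import Data.List.Relation.Unary.All.Properties using (++⁻ˡ)
open import Data.List.Membership.Propositional using () renaming (_∈_ to _∈ₗ_; _∉_ to _∉ₗ_)
open import Data.List.Membership.Propositional.Properties using (∈-map⁺; ∈-map⁻; ∈-allFin; ∈-++⁺ˡ; ∈-++⁺ʳ; ∈-∃++)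
import Data.List.Membership.DecPropositional as DecMembership
open import Data.List.Relation.Unary.Linked as Linked using (Linked; []; [-]; _∷_)
open import Data.List.Relation.Unary.Unique.Propositional using (Unique; []; _∷_)
open import Data.List.Relation.Unary.Unique.Propositional.Properties using (allFin⁺) renaming (map⁺ to map-injective⁺; ++⁺ to ++-disjoint⁺)
open import Data.Product using (Σ; ∃-syntax; _×_; _,_; proj₁; proj₂)
open import Data.Sum using (_⊎_; inj₁; inj₂)
open import Data.Empty using (⊥; ⊥-elim)
open import Relation.Nullary using (¬_; Dec; yes; no)
open import Relation.Nullary.Decidable using (⌊_⌋; _×-dec_; _⊎-dec_; ¬?)
open import Relation.Binary.PropositionalEquality using (_≡_; _≢_; refl; sym; trans; cong; cong₂; subst; subst₂)
open import Relation.Binary.Construct.Closure.ReflexiveTransitive using (Star; ε; _◅_; _◅◅_)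
open import Function.Bundles using (Equivalence)

-- Counting with duplicate-free lists

fresh∷ : ∀ {A : Set} {w : A} {vs : List A} → w ∉ₗ vs → Unique vs → Unique (w ∷ vs)
fresh∷ {vs = vs} w∉ u = All.tabulate (λ v∈ w≡v → w∉ (subst (_∈ₗ vs) (sym w≡v) v∈)) ∷ u

module _ {A : Set} where

  ∈-─ : ∀ {x z : A} (ys : List A) (x∈ys : x ∈ₗ ys) → z ∈ₗ ys → z ≢ x → z ∈ₗ (ys ─ₗ x∈ys)
  ∈-─ (_ ∷ _)  (here refl) (here refl) z≢x = ⊥-elim (z≢x refl)
  ∈-─ (_ ∷ _)  (here _)    (there z∈)  _   = z∈
  ∈-─ (_ ∷ _)  (there _)   (here refl) _   = here refl
  ∈-─ (_ ∷ ys) (there x∈)  (there z∈)  z≢x = there (∈-─ ys x∈ z∈ z≢x)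

  unique-length-≤ : ∀ {xs ys : List A} → Unique xs → (∀ {a} → a ∈ₗ xs → a ∈ₗ ys) →
                    length xs ≤ length ys
  unique-length-≤ {[]}     _          _   = z≤n
  unique-length-≤ {x ∷ xs} {ys} (x∉xs ∷ u) xs⊆ys = ≤-trans
    (s≤s (unique-length-≤ u (λ a∈ → ∈-─ ys x∈ys (xs⊆ys (there a∈)) (λ a≡x → All.lookup x∉xs a∈ (sym a≡x)))))
    (≤-reflexive (sym (length-removeAt′ ys _)))
    where x∈ys = xs⊆ys (here refl)

  map-unique : ∀ {B : Set} (f : A → B) {xs : List A} → Unique xs →
               (∀ {a b} → a ∈ₗ xs → b ∈ₗ xs → f a ≡ f b → a ≡ b) → Unique (map f xs)
  map-unique f {[]}     []         _   = []
  map-unique f {x ∷ xs} (x∉xs ∷ u) inj =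
    fresh∷ fx∉ (map-unique f u (λ a∈ b∈ → inj (there a∈) (there b∈)))
    where
    fx∉ : f x ∉ₗ map f xs
    fx∉ fx∈ with ∈-map⁻ f fx∈
    ... | a , a∈ , fx≡fa = All.lookup x∉xs a∈ (inj (here refl) (there a∈) fx≡fa)

-- Subsets of Fin m: enumeration, comprehension, and iteration

members : ∀ {m} → Subset m → List (Fin m)
members []            = []
members (inside ∷ p)  = zero ∷ map suc (members p)
members (outside ∷ p) = map suc (members p)

length-members : ∀ {m} (p : Subset m) → length (members p) ≡ ∣ p ∣
length-members []            = refl
length-members (inside ∷ p)  = cong suc (trans (length-map suc (members p)) (length-members p))
length-members (outside ∷ p) = trans (length-map suc (members p)) (length-members p)

∈-members⁺ : ∀ {m} (p : Subset m) {v} → v ∈ p → v ∈ₗ members p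
∈-members⁺ (inside ∷ p)  hereₛ        = here refl
∈-members⁺ (inside ∷ p)  (thereₛ v∈p) = there (∈-map⁺ suc (∈-members⁺ p v∈p))
∈-members⁺ (outside ∷ p) (thereₛ v∈p) = ∈-map⁺ suc (∈-members⁺ p v∈p)

∈-members⁻ : ∀ {m} (p : Subset m) {v} → v ∈ₗ members p → v ∈ p
∈-members⁻ (inside ∷ p)  (here refl) = hereₛ
∈-members⁻ (inside ∷ p)  (there v∈) with ∈-map⁻ suc v∈
... | w , w∈ , refl = thereₛ (∈-members⁻ p w∈)
∈-members⁻ (outside ∷ p) v∈ with ∈-map⁻ suc v∈
... | w , w∈ , refl = thereₛ (∈-members⁻ p w∈)

members-unique : ∀ {m} (p : Subset m) → Unique (members p)
members-unique []            = []
members-unique (inside ∷ p)  =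
  All.tabulate zero∉ ∷ map-injective⁺ suc-injective (members-unique p)
  where
  zero∉ : ∀ {v} → v ∈ₗ map suc (members p) → zero ≢ v
  zero∉ v∈ refl with ∈-map⁻ suc v∈
  ... | _ , _ , ()
members-unique (outside ∷ p) = map-injective⁺ suc-injective (members-unique p)

unique⇒length≤∣∣ : ∀ {m} {xs : List (Fin m)} (p : Subset m) → Unique xs →
                   (∀ {v} → v ∈ₗ xs → v ∈ p) → length xs ≤ ∣ p ∣
unique⇒length≤∣∣ p u xs⊆p =
  subst (_ ≤_) (length-members p) (unique-length-≤ u (λ v∈ → ∈-members⁺ p (xs⊆p v∈)))

covering⇒∣∣≤length : ∀ {m} {xs : List (Fin m)} (p : Subset m) →
                     (∀ {v} → v ∈ p → v ∈ₗ xs) → ∣ p ∣ ≤ length xs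
covering⇒∣∣≤length p p⊆xs =
  subst (_≤ _) (length-members p) (unique-length-≤ (members-unique p) (λ v∈ → p⊆xs (∈-members⁻ p v∈)))

select : ∀ {m} {P : Fin m → Set} → (∀ v → Dec (P v)) → Subset m
select P? = tabulate (λ v → ⌊ P? v ⌋)

∈-select⁺ : ∀ {m} {P : Fin m → Set} (P? : ∀ v → Dec (P v)) {v} → P v → v ∈ select P?
∈-select⁺ P? {v} pv with P? v | lookup∘tabulate (λ u → ⌊ P? u ⌋) v
... | yes _  | eq = lookup⇒[]= v _ eq
... | no ¬pv | _  = ⊥-elim (¬pv pv)

∈-select⁻ : ∀ {m} {P : Fin m → Set} (P? : ∀ v → Dec (P v)) {v} → v ∈ select P? → P v
∈-select⁻ P? {v} v∈ with P? v | trans (sym (lookup∘tabulate (λ u → ⌊ P? u ⌋) v)) ([]=⇒lookup v∈)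
... | yes pv | _  = pv
... | no _   | ()

iterate : ∀ {A : Set} → (A → A) → A → ℕ → A
iterate f a zero    = a
iterate f a (suc k) = f (iterate f a k)

module Stationary {m} (f : Subset m → Subset m) (inflationary : ∀ p → p ⊆ f p) where

  fixed-or-grows : ∀ p → f p ≡ p ⊎ ∣ p ∣ < ∣ f p ∣
  fixed-or-grows p with any? (λ v → v ∈? f p ×-dec ¬? (v ∈? p))
  ... | yes (v , v∈fp , v∉p) = inj₂ (p⊂q⇒∣p∣<∣q∣ (inflationary p , v , v∈fp , v∉p))
  ... | no  none = inj₁ (⊆-antisym fp⊆p (inflationary p))
    where
    fp⊆p : f p ⊆ p
    fp⊆p {v} v∈fp with v ∈? p
    ... | yes v∈p = v∈p
    ... | no  v∉p = ⊥-elim (none (v , v∈fp , v∉p))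

  stationary-or-large : ∀ p k → f (iterate f p k) ≡ iterate f p k ⊎ k ≤ ∣ iterate f p k ∣
  stationary-or-large p zero    = inj₂ z≤n
  stationary-or-large p (suc k) with stationary-or-large p k
  ... | inj₁ fixed = inj₁ (cong f fixed)
  ... | inj₂ large with fixed-or-grows (iterate f p k)
  ...   | inj₁ fixed = inj₁ (cong f fixed)
  ...   | inj₂ grows = inj₂ (≤-<-trans large grows)

  -- … so, as a subset of Fin m has at most m elements, they are stationary after m steps.
  stationary : ∀ p → f (iterate f p m) ≡ iterate f p m
  stationary p with stationary-or-large p m
  ... | inj₁ fixed = fixed
  ... | inj₂ large with fixed-or-grows (iterate f p m)
  ...   | inj₁ fixed = fixed
  ...   | inj₂ grows = ⊥-elim (<⇒≱ (≤-<-trans large grows) (∣p∣≤n (f (iterate f p m))))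

  iterate-⊆ : ∀ p k → p ⊆ iterate f p k
  iterate-⊆ p zero    v∈ = v∈
  iterate-⊆ p (suc k) v∈ = inflationary _ (iterate-⊆ p k v∈)

x∈p─q⇒x∉q : ∀ {m} (p q : Subset m) {x} → x ∈ p ─ q → x ∉ q
x∈p─q⇒x∉q (_ ∷ p) (inside  ∷ q) (thereₛ x∈) (thereₛ x∈q) = x∈p─q⇒x∉q p q x∈ x∈q
x∈p─q⇒x∉q (_ ∷ p) (outside ∷ q) (thereₛ x∈) (thereₛ x∈q) = x∈p─q⇒x∉q p q x∈ x∈q

∈-remove⁻ : ∀ {m} {p : Subset m} {v e} → v ∈ p - e → v ∈ p × v ≢ e
∈-remove⁻ {p = p} {e = e} v∈ =
  p─q⊆p p ⁅ e ⁆ v∈ , λ { refl → x∈p─q⇒x∉q p ⁅ e ⁆ v∈ (x∈⁅x⁆ e) }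

∈-insert⁻ : ∀ {m} {p : Subset m} {v e} → v ∈ p ∪ ⁅ e ⁆ → v ∈ p ⊎ v ≡ e
∈-insert⁻ {p = p} {e = e} v∈ with x∈p∪q⁻ p ⁅ e ⁆ v∈
... | inj₁ v∈p = inj₁ v∈p
... | inj₂ v∈e = inj₂ (x∈⁅y⁆⇒x≡y e v∈e)

∈-insert-old : ∀ {m} {p : Subset m} {v e} → v ∈ p → v ∈ p ∪ ⁅ e ⁆
∈-insert-old v∈p = x∈p∪q⁺ (inj₁ v∈p)

∈-insert-new : ∀ {m} {p : Subset m} {e} → e ∈ p ∪ ⁅ e ⁆
∈-insert-new {e = e} = x∈p∪q⁺ (inj₂ (x∈⁅x⁆ e))

-- Positional access to lists, with a default for out-of-range indices.
module _ {A : Set} where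

  nth : A → List A → ℕ → A
  nth d []      i       = d
  nth d (c ∷ l) zero    = c
  nth d (c ∷ l) (suc i) = nth d l i

  nth-∈ : ∀ d (l : List A) i → i < length l → nth d l i ∈ₗ l
  nth-∈ d (c ∷ l) zero    _       = here refl
  nth-∈ d (c ∷ l) (suc i) (s≤s p) = there (nth-∈ d l i p)

  ∈⇒nth : ∀ d (l : List A) {c} → c ∈ₗ l → ∃[ i ] (i < length l × nth d l i ≡ c)
  ∈⇒nth d (c ∷ l) (here refl) = 0 , s≤s z≤n , refl
  ∈⇒nth d (c ∷ l) (there c∈)  with ∈⇒nth d l c∈
  ... | i , i< , eq = suc i , s≤s i< , eq

  nth-injective : ∀ d (l : List A) → Unique l → ∀ i j → i < length l → j < length l →
                  nth d l i ≡ nth d l j → i ≡ j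
  nth-injective d (c ∷ l) _         zero    zero    _       _       _  = refl
  nth-injective d (c ∷ l) (c∉ ∷ _)  zero    (suc j) _       (s≤s q) eq = ⊥-elim (All.lookup c∉ (nth-∈ d l j q) eq)
  nth-injective d (c ∷ l) (c∉ ∷ _)  (suc i) zero    (s≤s p) _       eq = ⊥-elim (All.lookup c∉ (nth-∈ d l i p) (sym eq))
  nth-injective d (c ∷ l) (_  ∷ u)  (suc i) (suc j) (s≤s p) (s≤s q) eq = cong suc (nth-injective d l u i j p q eq)

  nth-linked : ∀ {R : A → A → Set} d (l : List A) → Linked R l → ∀ i → suc i < length l →
               R (nth d l i) (nth d l (suc i))
  nth-linked d (c ∷ c′ ∷ l) (r ∷ _)  zero    _       = r
  nth-linked d (c ∷ c′ ∷ l) (_ ∷ lk) (suc i) (s≤s p) = nth-linked d (c′ ∷ l) lk i p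
  nth-linked d (c ∷ [])     [-]      zero    (s≤s ())

  nth-last : ∀ d (pre : List A) z → nth d (pre ++ [ z ]) (length pre) ≡ z
  nth-last d []        z = refl
  nth-last d (c ∷ pre) z = nth-last d pre z

sucMod-cases : ∀ {m} (i : Fin (suc m)) → (toℕ i ≡ m × sucMod i ≡ zero) ⊎ toℕ (sucMod i) ≡ suc (toℕ i)
sucMod-cases {zero}  zero = inj₁ (refl , refl)
sucMod-cases {suc m} zero = inj₂ refl
sucMod-cases {suc m} (suc j) with sucMod {m} j | sucMod-cases {m} j
... | zero   | inj₁ (j≡m , _) = inj₁ (cong suc j≡m , refl)
... | zero   | inj₂ ()
... | suc j′ | inj₁ (_ , ())
... | suc j′ | inj₂ eq = inj₂ (cong suc eq)

unique-prefix : ∀ {A : Set} (xs : List A) {ys} → Unique (xs ++ ys) → Unique xs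
unique-prefix []       _          = []
unique-prefix (x ∷ xs) (x∉ ∷ u) = ++⁻ˡ xs x∉ ∷ unique-prefix xs u

linked-prefix : ∀ {A : Set} {R : A → A → Set} (xs : List A) {ys} → Linked R (xs ++ ys) → Linked R xs
linked-prefix []           _        = []
linked-prefix (x ∷ [])     _        = [-]
linked-prefix (x ∷ x′ ∷ xs) (r ∷ lk) = r ∷ linked-prefix (x′ ∷ xs) lk

module Graphs (G : Graph) where

  V : Set
  V = Fin (n G)

  adj? : ∀ u v → Dec (Adj G u v)
  adj? u v = adj G u v ≟ᵇ true

  Adj-sym : ∀ {u v} → Adj G u v → Adj G v u
  Adj-sym {u} {v} uv = trans (Graph.sym G v u) uv

  Adj⇒≢ : ∀ {u v} → Adj G u v → u ≢ v
  Adj⇒≢ {v = v} vv refl with trans (sym (irrefl G v)) vv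
  ... | ()

  open Matching

  EndOf : ∀ {m} → Matching G m → Fin m → V → Set
  EndOf M i u = u ≡ a M i ⊎ u ≡ b M i

  distinct-edges-disjoint : ∀ {m} (M : Matching G m) {i j u v} → i ≢ j →
                            EndOf M i u → EndOf M j v → u ≢ v
  distinct-edges-disjoint M {i} {j} i≢j u-end v-end u≡v
    with disjoint M i j i≢j | u-end | v-end
  ... | aa , _  , _  , _  | inj₁ refl | inj₁ refl = aa u≡v
  ... | _  , ab , _  , _  | inj₁ refl | inj₂ refl = ab u≡v
  ... | _  , _  , ba , _  | inj₂ refl | inj₁ refl = ba u≡v
  ... | _  , _  , _  , bb | inj₂ refl | inj₂ refl = bb u≡v

  shared-end⇒same-edge : ∀ {m} (M : Matching G m) {i j u} →
                         EndOf M i u → EndOf M j u → i ≡ j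
  shared-end⇒same-edge M {i} {j} u-end u-end′ with i ≟ᶠ j
  ... | yes i≡j = i≡j
  ... | no  i≢j = ⊥-elim (distinct-edges-disjoint M i≢j u-end u-end′ refl)

  noMatching : Matching G 0
  noMatching = record { a = λ () ; b = λ () ; isEdge = λ () ; disjoint = λ () }

  Avoids : ∀ {m} → Matching G m → V → Set
  Avoids M v = ∀ i → ¬ EndOf M i v

  extend : ∀ {m e w} (M : Matching G m) → Adj G e w → Avoids M e → Avoids M w → Matching G (suc m)
  extend {m} {e} {w} M ew e-free w-free = record { a = a′ ; b = b′ ; isEdge = isEdge′ ; disjoint = disj }
    where
    a′ b′ : Fin (suc m) → V
    a′ zero = e
    a′ (suc i) = a M i
    b′ zero = w
    b′ (suc i) = b M i
    isEdge′ : ∀ i → Adj G (a′ i) (b′ i)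
    isEdge′ zero    = ew
    isEdge′ (suc i) = isEdge M i
    new-old : ∀ j → (e ≢ a M j) × (e ≢ b M j) × (w ≢ a M j) × (w ≢ b M j)
    new-old j = (λ eq → e-free j (inj₁ eq)) , (λ eq → e-free j (inj₂ eq))
              , (λ eq → w-free j (inj₁ eq)) , (λ eq → w-free j (inj₂ eq))
    disj : ∀ i j → i ≢ j → (a′ i ≢ a′ j) × (a′ i ≢ b′ j) × (b′ i ≢ a′ j) × (b′ i ≢ b′ j)
    disj zero    zero    0≢0 = ⊥-elim (0≢0 refl)
    disj zero    (suc j) _   = new-old j
    disj (suc i) zero    _   = let (ea , eb , wa , wb) = new-old i in
                               (λ eq → ea (sym eq)) , (λ eq → wa (sym eq))
                             , (λ eq → eb (sym eq)) , (λ eq → wb (sym eq))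
    disj (suc i) (suc j) i≢j = disjoint M i j (λ i≡j → i≢j (cong suc i≡j))

  -- Every edge of a matching has an endpoint outside a given independent set,
  -- and these endpoints are distinct; so |S| + |M| ≤ n.
  independent+matching≤n : ∀ {S m} → Independent G S → Matching G m → ∣ S ∣ + m ≤ n G
  independent+matching≤n {S} {m} S-indep M = subst₂ _≤_ length≡ (∣⊤∣≡n (n G))
    (unique⇒length≤∣∣ ⊤ (++-disjoint⁺ (members-unique S) (map-injective⁺ end-injective (allFin⁺ m)) apart)
                        (λ _ → ∈⊤))
    where
    outerEnd : ∀ i → Σ V λ u → u ∉ S × EndOf M i u
    outerEnd i with a M i ∈? S
    ... | yes a∈S = b M i , (λ b∈S → S-indep _ _ a∈S b∈S (isEdge M i)) , inj₂ refl
    ... | no  a∉S = a M i , a∉S , inj₁ refl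
    end : Fin m → V
    end i = proj₁ (outerEnd i)
    end-injective : ∀ {i j} → end i ≡ end j → i ≡ j
    end-injective {i} {j} eq =
      shared-end⇒same-edge M (proj₂ (proj₂ (outerEnd i)))
                             (subst (EndOf M j) (sym eq) (proj₂ (proj₂ (outerEnd j))))
    apart : ∀ {v} → ¬ (v ∈ₗ members S × v ∈ₗ map end (allFin m))
    apart (v∈S , v∈ends) with ∈-map⁻ end v∈ends
    ... | i , _ , refl = proj₁ (proj₂ (outerEnd i)) (∈-members⁻ S v∈S)
    length≡ : length (members S ++ map end (allFin m)) ≡ ∣ S ∣ + m
    length≡ = trans (length-++ (members S))
                    (cong₂ _+_ (length-members S) (trans (length-map end (allFin m)) (length-tabulate (λ i → i))))

  -- An independent set and a matching with |S| + |M| ≥ n are both maximum,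
  -- so they witness α(G) + μ(G) = n.
  tight⇒KönigEgerváry : ∀ {S m} → Independent G S → Matching G m → n G ≤ ∣ S ∣ + m → KonigEgervary G
  tight⇒KönigEgerváry {S} {m} S-indep M n≤ =
    ∣ S ∣ , m , ((S , S-indep , refl) , α-bound) , (M , μ-bound) , ≤-antisym (independent+matching≤n S-indep M) n≤
    where
    α-bound : ∀ S′ → Independent G S′ → ∣ S′ ∣ ≤ ∣ S ∣
    α-bound S′ S′-indep = +-cancelʳ-≤ m _ _ (≤-trans (independent+matching≤n S′-indep M) n≤)
    μ-bound : ∀ m′ → Matching G m′ → m′ ≤ m
    μ-bound m′ M′ = +-cancelˡ-≤ ∣ S ∣ _ _ (≤-trans (independent+matching≤n S-indep M′) n≤)

module Cycles (G : Graph) where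
  open Graphs G

  closeCycle : (a b : V) (mid : List V) (z : V) →
               Unique (a ∷ b ∷ mid ++ [ z ]) → Linked (Adj G) (a ∷ b ∷ mid ++ [ z ]) → Adj G z a →
               Σ (Cycle G) λ D → (∀ i → vtx D i ∈ₗ (a ∷ b ∷ mid ++ [ z ]))
                               × (∀ {c} → c ∈ₗ (a ∷ b ∷ mid ++ [ z ]) → OnCycle D c)
  closeCycle a b mid z unique linked za = D , on-path , on-cycle
    where
    path = a ∷ b ∷ mid ++ [ z ]
    length-path : length path ≡ 3 + length mid
    length-path = cong (λ l → suc (suc l)) (trans (length-++ mid) (+-comm (length mid) 1))
    vertex : Fin (3 + length mid) → V
    vertex i = nth a path (toℕ i)
    in-range : (i : Fin (3 + length mid)) → toℕ i < length path
    in-range i = subst (toℕ i <_) (sym length-path) (toℕ<n i)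
    edge : ∀ i → Adj G (vertex i) (vertex (sucMod i))
    edge i with sucMod i | sucMod-cases i
    ... | _ | inj₁ (last , refl) =
      subst (λ v → Adj G v a) (sym (trans (cong (nth a path) last) (nth-last a (a ∷ b ∷ mid) z))) za
    ... | j | inj₂ next = subst (λ t → Adj G (vertex i) (nth a path t)) (sym next)
                            (nth-linked a path linked (toℕ i) (subst (_< length path) next (in-range j)))
    D : Cycle G
    D = record { k = length mid ; vtx = vertex
               ; inj = λ {i} {j} eq → toℕ-injective (nth-injective a path unique (toℕ i) (toℕ j) (in-range i) (in-range j) eq)
               ; edges = edge }
    on-path : ∀ i → vertex i ∈ₗ path
    on-path i = nth-∈ a path (toℕ i) (in-range i)
    on-cycle : ∀ {c} → c ∈ₗ path → OnCycle D c
    on-cycle c∈ with ∈⇒nth a path c∈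
    ... | i , i< , eq = let i<3+ = subst (i <_) length-path i< in
                        fromℕ< i<3+ , trans (cong (nth a path) (toℕ-fromℕ< i<3+)) eq

  sameEdges⇒sameVertices : (C D : Cycle G) → (∀ u w → CycleEdge C u w → CycleEdge D u w) →
                           ∀ {v} → OnCycle C v → OnCycle D v
  sameEdges⇒sameVertices C D C⊆D (j , refl) with C⊆D (vtx C j) (vtx C (sucMod j)) (j , inj₁ (refl , refl))
  ... | i , inj₁ (vi≡ , _) = i , vi≡
  ... | i , inj₂ (_ , vi+1≡) = sucMod i , vi+1≡

  module Unicyclic (C : Cycle G) (unique : ∀ (D : Cycle G) → SameCycle C D) where

    onC⇒onD : ∀ D {v} → OnCycle C v → OnCycle D v
    onC⇒onD D = sameEdges⇒sameVertices C D (λ u w → Equivalence.to (unique D u w))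

    onD⇒onC : ∀ D {v} → OnCycle D v → OnCycle C v
    onD⇒onC D = sameEdges⇒sameVertices D C (λ u w → Equivalence.from (unique D u w))

-- König decompositions: certificates of α + μ = |A| for the graph induced on
-- a vertex set A, and the operations that build them up.
module KönigDecompositions (G : Graph) where
  open Graphs G
  open Matching

  record KönigDecomposition (A : Subset (n G)) : Set where
    field
      S           : Subset (n G)
      size        : ℕ
      M           : Matching G size
      S⊆A         : S ⊆ A
      independent : Independent G S
      source∈S    : ∀ i → a M i ∈ S
      target∈A    : ∀ i → b M i ∈ A
      target∉S    : ∀ i → b M i ∉ S
      covers      : ∀ {v} → v ∈ A → v ∉ S → ∃[ i ] b M i ≡ v

    end∈A : ∀ {i u} → EndOf M i u → u ∈ A
    end∈A {i} (inj₁ refl) = S⊆A (source∈S i)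
    end∈A {i} (inj₂ refl) = target∈A i

  open KönigDecomposition

  SourceFree : ∀ {A} → V → KönigDecomposition A → Set
  SourceFree x K = ∀ i → a (M K) i ≢ x

  -- A decomposition whose set contains every vertex witnesses König–Egerváry:
  -- S together with the targets of M exhaust V, so |S| + |M| ≥ n.
  spanning⇒KönigEgerváry : ∀ {A} (K : KönigDecomposition A) → (∀ v → v ∈ A) → KonigEgervary G
  spanning⇒KönigEgerváry K all∈A = tight⇒KönigEgerváry (independent K) (M K)
    (subst₂ _≤_ (∣⊤∣≡n (n G)) length≡ (covering⇒∣∣≤length ⊤ listed))
    where
    listed : ∀ {v} → v ∈ ⊤ → v ∈ₗ members (S K) ++ map (b (M K)) (allFin (size K))
    listed {v} _ with v ∈? S K
    ... | yes v∈S = ∈-++⁺ˡ (∈-members⁺ (S K) v∈S)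
    ... | no  v∉S with covers K (all∈A v) v∉S
    ... | i , refl = ∈-++⁺ʳ (members (S K)) (∈-map⁺ (b (M K)) (∈-allFin i))
    length≡ : length (members (S K) ++ map (b (M K)) (allFin (size K))) ≡ ∣ S K ∣ + size K
    length≡ = trans (length-++ (members (S K)))
                    (cong₂ _+_ (length-members (S K)) (trans (length-map _ (allFin (size K))) (length-tabulate (λ i → i))))

  emptyDecomposition : ∀ {A} x → (∀ v → v ∉ A) → Σ (KönigDecomposition A) (SourceFree x)
  emptyDecomposition {A} x none = record
    { S = A ; size = 0 ; M = noMatching ; S⊆A = λ v∈ → v∈
    ; independent = λ u _ u∈ _ _ → none u u∈
    ; source∈S = λ () ; target∈A = λ () ; target∉S = λ () ; covers = λ v∈ v∉ → ⊥-elim (v∉ v∈) }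
    , λ ()

  addIsolated : ∀ {A e x} → e ∈ A → (∀ {u} → u ∈ A → ¬ Adj G e u) →
                Σ (KönigDecomposition (A - e)) (SourceFree x) → Σ (KönigDecomposition A) (SourceFree x)
  addIsolated {A} {e} e∈A isolated (K , free) = record
    { S = S K ∪ ⁅ e ⁆ ; size = size K ; M = M K ; S⊆A = S′⊆A ; independent = indep
    ; source∈S = λ i → ∈-insert-old (source∈S K i)
    ; target∈A = λ i → proj₁ (∈-remove⁻ (target∈A K i))
    ; target∉S = target∉S′ ; covers = covers′ }
    , free
    where
    S′⊆A : ∀ {v} → v ∈ S K ∪ ⁅ e ⁆ → v ∈ A
    S′⊆A v∈ with ∈-insert⁻ v∈
    ... | inj₁ v∈S = proj₁ (∈-remove⁻ (S⊆A K v∈S))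
    ... | inj₂ refl = e∈A
    indep : Independent G (S K ∪ ⁅ e ⁆)
    indep u v u∈ v∈ uv with ∈-insert⁻ u∈ | ∈-insert⁻ v∈
    ... | inj₁ u∈S | inj₁ v∈S = independent K u v u∈S v∈S uv
    ... | inj₁ u∈S | inj₂ refl = isolated (S′⊆A u∈) (Adj-sym uv)
    ... | inj₂ refl | _ = isolated (S′⊆A v∈) uv
    target∉S′ : ∀ i → b (M K) i ∉ S K ∪ ⁅ e ⁆
    target∉S′ i t∈ with ∈-insert⁻ t∈
    ... | inj₁ t∈S = target∉S K i t∈S
    ... | inj₂ t≡e = proj₂ (∈-remove⁻ (target∈A K i)) t≡e
    covers′ : ∀ {v} → v ∈ A → v ∉ S K ∪ ⁅ e ⁆ → ∃[ i ] b (M K) i ≡ v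
    covers′ v∈A v∉ = covers K (x∈p∧x≢y⇒x∈p-y v∈A (λ { refl → v∉ ∈-insert-new })) (λ v∈S → v∉ (∈-insert-old v∈S))

  addLeaf : ∀ {A e w x} → e ∈ A → w ∈ A → Adj G e w → (∀ {u} → u ∈ A → Adj G e u → u ≡ w) → e ≢ x →
            Σ (KönigDecomposition (A - e - w)) (SourceFree x) → Σ (KönigDecomposition A) (SourceFree x)
  addLeaf {A} {e} {w} {x} e∈A w∈A ew leaf e≢x (K , free) = record
    { S = S K ∪ ⁅ e ⁆ ; size = suc (size K) ; M = M′ ; S⊆A = S′⊆A ; independent = indep
    ; source∈S = λ { zero → ∈-insert-new ; (suc i) → ∈-insert-old (source∈S K i) }
    ; target∈A = λ { zero → w∈A ; (suc i) → in-A (target∈A K i) }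
    ; target∉S = target∉S′ ; covers = covers′ }
    , λ { zero → e≢x ; (suc i) → free i }
    where
    in-A : ∀ {v} → v ∈ A - e - w → v ∈ A
    in-A v∈ = proj₁ (∈-remove⁻ (proj₁ (∈-remove⁻ v∈)))
    ≢e : ∀ {v} → v ∈ A - e - w → v ≢ e
    ≢e v∈ = proj₂ (∈-remove⁻ (proj₁ (∈-remove⁻ v∈)))
    ≢w : ∀ {v} → v ∈ A - e - w → v ≢ w
    ≢w v∈ = proj₂ (∈-remove⁻ v∈)
    M′ : Matching G (suc (size K))
    M′ = extend (M K) ew (λ i end → ≢e (end∈A K end) refl) (λ i end → ≢w (end∈A K end) refl)
    S′⊆A : ∀ {v} → v ∈ S K ∪ ⁅ e ⁆ → v ∈ A
    S′⊆A v∈ with ∈-insert⁻ v∈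
    ... | inj₁ v∈S = in-A (S⊆A K v∈S)
    ... | inj₂ refl = e∈A
    -- the only neighbour of e in A is w, which is not in S
    e-apart : ∀ {u} → u ∈ S K → ¬ Adj G e u
    e-apart u∈S eu = ≢w (S⊆A K u∈S) (leaf (in-A (S⊆A K u∈S)) eu)
    indep : Independent G (S K ∪ ⁅ e ⁆)
    indep u v u∈ v∈ uv with ∈-insert⁻ u∈ | ∈-insert⁻ v∈
    ... | inj₁ u∈S  | inj₁ v∈S  = independent K u v u∈S v∈S uv
    ... | inj₁ u∈S  | inj₂ refl = e-apart u∈S (Adj-sym uv)
    ... | inj₂ refl | inj₁ v∈S  = e-apart v∈S uv
    ... | inj₂ refl | inj₂ refl = Adj⇒≢ uv refl
    target∉S′ : ∀ i → b M′ i ∉ S K ∪ ⁅ e ⁆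
    target∉S′ i t∈ with i | ∈-insert⁻ t∈
    ... | zero  | inj₁ w∈S = ≢w (S⊆A K w∈S) refl
    ... | zero  | inj₂ w≡e = Adj⇒≢ ew (sym w≡e)
    ... | suc j | inj₁ t∈S = target∉S K j t∈S
    ... | suc j | inj₂ t≡e = ≢e (target∈A K j) t≡e
    covers′ : ∀ {v} → v ∈ A → v ∉ S K ∪ ⁅ e ⁆ → ∃[ i ] b M′ i ≡ v
    covers′ {v} v∈A v∉ with v ≟ᶠ w
    ... | yes refl = zero , refl
    ... | no  v≢w with covers K (x∈p∧x≢y⇒x∈p-y (x∈p∧x≢y⇒x∈p-y v∈A (λ { refl → v∉ ∈-insert-new })) v≢w)
                                 (λ v∈S → v∉ (∈-insert-old v∈S))
    ... | i , bi≡v = suc i , bi≡v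

  attachPendant : ∀ {A x y} (K : KönigDecomposition A) → x ∈ S K → SourceFree x K → y ∉ A → Adj G x y →
                  KönigDecomposition (A ∪ ⁅ y ⁆)
  attachPendant {A} {x} {y} K x∈S free y∉A xy = record
    { S = S K ; size = suc (size K) ; M = M′ ; S⊆A = λ v∈S → ∈-insert-old (S⊆A K v∈S)
    ; independent = independent K
    ; source∈S = λ { zero → x∈S ; (suc i) → source∈S K i }
    ; target∈A = λ { zero → ∈-insert-new ; (suc i) → ∈-insert-old (target∈A K i) }
    ; target∉S = λ { zero y∈S → y∉A (S⊆A K y∈S) ; (suc i) → target∉S K i }
    ; covers = covers′ }
    where
    x-free : Avoids (M K) x
    x-free i (inj₁ x≡ai) = free i (sym x≡ai)
    x-free i (inj₂ x≡bi) = target∉S K i (subst (_∈ S K) x≡bi x∈S)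
    M′ : Matching G (suc (size K))
    M′ = extend (M K) xy x-free (λ i end → y∉A (end∈A K end))
    covers′ : ∀ {v} → v ∈ A ∪ ⁅ y ⁆ → v ∉ S K → ∃[ i ] b M′ i ≡ v
    covers′ v∈ v∉S with ∈-insert⁻ v∈
    ... | inj₁ v∈A = let (i , eq) = covers K v∈A v∉S in suc i , eq
    ... | inj₂ refl = zero , refl

  representative : ∀ {A} → KönigDecomposition A → V → V
  representative K v with v ∈? S K
  ... | yes _ = v
  ... | no  _ with any? (λ i → b (M K) i ≟ᶠ v)
  ...   | yes (i , _) = a (M K) i
  ...   | no  _       = v

  Representation : ∀ {A} → KönigDecomposition A → V → Set
  Representation K v = (v ∈ S K × representative K v ≡ v)
                     ⊎ ∃[ i ] (b (M K) i ≡ v × representative K v ≡ a (M K) i)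

  representation : ∀ {A} (K : KönigDecomposition A) {v} → v ∈ A → Representation K v
  representation K {v} v∈A with v ∈? S K
  ... | yes v∈S = inj₁ (v∈S , refl)
  ... | no  v∉S with any? (λ i → b (M K) i ≟ᶠ v)
  ...   | yes (i , bi≡v) = inj₂ (i , bi≡v , refl)
  ...   | no  unmatched  = ⊥-elim (unmatched (covers K v∈A v∉S))

  representative-near : ∀ {A} (K : KönigDecomposition A) {v} → v ∈ A →
                        representative K v ∈ S K × (representative K v ≡ v ⊎ Adj G v (representative K v))
  representative-near K v∈A with representation K v∈A
  ... | inj₁ (v∈S , rv) = subst (_∈ S K) (sym rv) v∈S , inj₁ rv
  ... | inj₂ (i , refl , rv) =
    subst (_∈ S K) (sym rv) (source∈S K i) , inj₂ (subst (Adj G _) (sym rv) (Adj-sym (isEdge (M K) i)))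

  -- Non-adjacent vertices of A have distinct representatives: two vertices
  -- with a common representative are equal or joined by a matched edge.
  representative-injective : ∀ {A} (K : KönigDecomposition A) {u v} → u ∈ A → v ∈ A → ¬ Adj G u v →
                             representative K u ≡ representative K v → u ≡ v
  representative-injective K u∈A v∈A u≁v eq with representation K u∈A | representation K v∈A
  ... | inj₁ (_ , ru) | inj₁ (_ , rv) = trans (sym ru) (trans eq rv)
  ... | inj₁ (_ , ru) | inj₂ (j , refl , rv) =
    ⊥-elim (u≁v (subst (λ t → Adj G t _) (trans (sym rv) (trans (sym eq) ru)) (isEdge (M K) j)))
  ... | inj₂ (i , refl , ru) | inj₁ (_ , rv) =
    ⊥-elim (u≁v (Adj-sym (subst (λ t → Adj G t _) (trans (sym ru) (trans eq rv)) (isEdge (M K) i))))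
  ... | inj₂ (i , refl , ru) | inj₂ (j , refl , rv) =
    cong (b (M K)) (shared-end⇒same-edge (M K) (inj₁ refl) (inj₁ (trans (sym ru) (trans eq rv))))

  -- The S-part of a set T ⊆ A closed under the edges of G inside A (a union
  -- of components of G[A]) is a maximum independent set of T: representatives
  -- inject every independent Q ⊆ T into S ∩ T.
  restriction-maximum : ∀ {A T} (K : KönigDecomposition A) → T ⊆ A →
                        (∀ {u v} → u ∈ T → v ∈ A → Adj G u v → v ∈ T) →
                        ∀ Q → Q ⊆ T → Independent G Q → ∣ Q ∣ ≤ ∣ S K ∩ T ∣
  restriction-maximum {A} {T} K T⊆A closed Q Q⊆T Q-indep =
    subst (_≤ ∣ S K ∩ T ∣) (trans (length-map (representative K) (members Q)) (length-members Q))
          (unique⇒length≤∣∣ (S K ∩ T) (map-unique (representative K) (members-unique Q) injective) into-S∩T)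
    where
    in-A : ∀ {v} → v ∈ₗ members Q → v ∈ A
    in-A v∈ = T⊆A (Q⊆T (∈-members⁻ Q v∈))
    injective : ∀ {u v} → u ∈ₗ members Q → v ∈ₗ members Q → representative K u ≡ representative K v → u ≡ v
    injective u∈ v∈ = representative-injective K (in-A u∈) (in-A v∈)
                        (Q-indep _ _ (∈-members⁻ Q u∈) (∈-members⁻ Q v∈))
    into-S∩T : ∀ {w} → w ∈ₗ map (representative K) (members Q) → w ∈ S K ∩ T
    into-S∩T w∈ with ∈-map⁻ (representative K) w∈
    ... | v , v∈ , refl with representative-near K (in-A v∈)
    ...   | r∈S , inj₁ rv = x∈p∩q⁺ (r∈S , subst (_∈ T) (sym rv) (Q⊆T (∈-members⁻ Q v∈)))
    ...   | r∈S , inj₂ vr = x∈p∩q⁺ (r∈S , closed (Q⊆T (∈-members⁻ Q v∈)) (S⊆A K r∈S) vr)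

-- Forests: acyclic vertex sets have pendant vertices, and therefore
-- König decompositions.
module Forests (G : Graph) where
  open Graphs G
  open Cycles G
  open KönigDecompositions G
  open DecMembership (_≟ᶠ_ {n G}) using () renaming (_∈?_ to _∈ₗ?_)

  Acyclic : Subset (n G) → Set
  Acyclic A = (D : Cycle G) → (∀ i → vtx D i ∈ A) → ⊥

  acyclic-⊆ : ∀ {A B} → B ⊆ A → Acyclic A → Acyclic B
  acyclic-⊆ B⊆A acyclic D in-B = acyclic D (λ i → B⊆A (in-B i))

  -- A path inside A from s to end, listed backwards from its end.
  record PathIn (A : Subset (n G)) (s : V) : Set where
    constructor path
    field
      end    : V
      rest   : List V
      unique : Unique (end ∷ rest)
      linked : Linked (Adj G) (end ∷ rest)
      within : All (_∈ A) (end ∷ rest)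
      starts : (rest ≡ [] × end ≡ s) ⊎ s ∈ₗ rest

  open PathIn

  Maximal : ∀ {A s} → PathIn A s → Set
  Maximal {A} P = ∀ {u} → u ∈ A → Adj G (end P) u → u ∈ₗ (end P ∷ rest P)

  -- Prolonging paths greedily ends after at most n steps, since a path has
  -- at most n vertices.
  prolong : ∀ {A s} fuel (P : PathIn A s) → n G ≤ length (end P ∷ rest P) + fuel → Σ (PathIn A s) Maximal
  prolong {A} {s} fuel P n≤ with any? (λ w → w ∈? A ×-dec adj? (end P) w ×-dec ¬? (w ∈ₗ? (end P ∷ rest P)))
  ... | no stuck = P , maximal
    where
    maximal : Maximal P
    maximal {u} u∈A eu with u ∈ₗ? (end P ∷ rest P)
    ... | yes on = on
    ... | no off = ⊥-elim (stuck (u , u∈A , eu , off))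
  ... | yes (w , w∈A , ew , w∉) with fuel
  ...   | zero = ⊥-elim (<⇒≱ (s≤s (subst (n G ≤_) (+-identityʳ _) n≤)) too-long)
    where
    too-long : length (w ∷ end P ∷ rest P) ≤ n G
    too-long = subst (length (w ∷ end P ∷ rest P) ≤_) (∣⊤∣≡n (n G))
                     (unique⇒length≤∣∣ ⊤ (fresh∷ w∉ (unique P)) (λ _ → ∈⊤))
  ...   | suc fuel′ = prolong fuel′ longer (subst (n G ≤_) (+-suc _ fuel′) n≤)
    where
    longer : PathIn A s
    longer = path w (end P ∷ rest P)
                  (fresh∷ w∉ (unique P))
                  (Adj-sym ew ∷ linked P) (w∈A ∷ within P)
                  (inj₂ (starts-at (starts P)))
      where
      starts-at : (rest P ≡ [] × end P ≡ s) ⊎ s ∈ₗ rest P → s ∈ₗ (end P ∷ rest P)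
      starts-at (inj₁ (_ , refl)) = here refl
      starts-at (inj₂ s∈)         = there s∈

  maximalPath : ∀ {A s} → s ∈ A → Σ (PathIn A s) Maximal
  maximalPath {s = s} s∈A = prolong (n G) (path s [] ([] ∷ []) [-] (s∈A ∷ []) (inj₁ (refl , refl))) (m≤n+m (n G) 1)

  data Pendant (A : Subset (n G)) (s : V) : Set where
    isolated : (∀ {u} → u ∈ A → ¬ Adj G s u) → Pendant A s
    leaf     : ∀ {e w} → e ∈ A → w ∈ A → Adj G e w → e ≢ s →
               (∀ {u} → u ∈ A → Adj G e u → u ≡ w) → Pendant A s

  -- The end of a maximal path from s is such a vertex: an A-neighbour of the
  -- end further back along the path would close a cycle inside A.
  pendant : ∀ {A s} → Acyclic A → s ∈ A → Pendant A s
  pendant {A} {s} acyclic s∈A with maximalPath s∈A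
  ... | path e [] _ _ _ (inj₁ (_ , refl)) , maximal = isolated isolated-s
    where
    isolated-s : ∀ {u} → u ∈ A → ¬ Adj G e u
    isolated-s u∈A eu with maximal u∈A eu
    ... | here refl = Adj⇒≢ eu refl
  ... | path e [] _ _ _ (inj₂ ()) , _
  ... | path e (w ∷ rest) (e∉ ∷ unique) (ew ∷ linked) within@(e∈A ∷ w∈A ∷ _) starts , maximal =
    leaf e∈A w∈A ew e≢s only-w
    where
    -- s lies further back on the path, and the path has no repetitions
    e≢s : e ≢ s
    e≢s = s-behind starts
      where
      s-behind : (w ∷ rest ≡ [] × e ≡ s) ⊎ s ∈ₗ (w ∷ rest) → e ≢ s
      s-behind (inj₁ (() , _))
      s-behind (inj₂ s∈) e≡s = All.lookup e∉ s∈ e≡s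
    no-back-edge : ∀ {u} → u ∈ₗ rest → ¬ Adj G e u
    no-back-edge {u} u∈ eu with ∈-∃++ u∈
    ... | pre , post , refl = acyclic D (λ i → All.lookup within (on-whole (on-path i)))
      where
      cyc : List V
      cyc = e ∷ w ∷ pre ++ [ u ]
      whole≡ : cyc ++ post ≡ e ∷ w ∷ pre ++ [ u ] ++ post
      whole≡ = cong (λ l → e ∷ w ∷ l) (++-assoc pre [ u ] post)
      on-whole : ∀ {c} → c ∈ₗ cyc → c ∈ₗ (e ∷ w ∷ pre ++ [ u ] ++ post)
      on-whole {c} c∈ = subst (c ∈ₗ_) whole≡ (∈-++⁺ˡ c∈)
      closed : Σ (Cycle G) λ D → (∀ i → vtx D i ∈ₗ cyc) × (∀ {c} → c ∈ₗ cyc → OnCycle D c)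
      closed = closeCycle e w pre u (unique-prefix cyc (subst Unique (sym whole≡) (e∉ ∷ unique)))
                                   (linked-prefix cyc (subst (Linked (Adj G)) (sym whole≡) (ew ∷ linked)))
                                   (Adj-sym eu)
      D : Cycle G
      D = proj₁ closed
      on-path : ∀ i → vtx D i ∈ₗ cyc
      on-path = proj₁ (proj₂ closed)
    only-w : ∀ {u} → u ∈ A → Adj G e u → u ≡ w
    only-w u∈A eu with maximal u∈A eu
    ... | here refl         = ⊥-elim (Adj⇒≢ eu refl)
    ... | there (here refl) = refl
    ... | there (there u∈)  = ⊥-elim (no-back-edge u∈ eu)

  startVertex : ∀ {A} x → Nonempty A → Σ V λ s → s ∈ A × (∀ {e} → e ∈ A → e ≢ s → e ≢ x)
  startVertex {A} x (v , v∈A) with x ∈? A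
  ... | yes x∈A = x , x∈A , λ _ e≢x → e≢x
  ... | no  x∉A = v , v∈A , λ { e∈A _ refl → x∉A e∈A }

  decompose : ∀ x {A} → Acc _⊂_ A → Acyclic A → Σ (KönigDecomposition A) (SourceFree x)
  decompose x {A} (acc smaller) acyclic with nonempty? A
  ... | no empty = emptyDecomposition x (λ v v∈A → empty (v , v∈A))
  ... | yes nonempty with startVertex x nonempty
  ...   | s , s∈A , ≢s⇒≢x with pendant acyclic s∈A
  ...     | isolated iso = addIsolated s∈A iso
                             (decompose x (smaller (x∈p⇒p-x⊂p s∈A)) (acyclic-⊆ (p─q⊆p A _) acyclic))
  ...     | leaf {e} {w} e∈A w∈A ew e≢s only-w = addLeaf e∈A w∈A ew only-w (≢s⇒≢x e∈A e≢s)
                             (decompose x (smaller (⊆-⊂-trans (p─q⊆p (A - e) _) (x∈p⇒p-x⊂p e∈A)))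
                                        (acyclic-⊆ (λ v∈ → p─q⊆p A _ (p─q⊆p (A - e) _ v∈)) acyclic))

-- The vertex set of T_x, the component of x in G - xy, computed by breadth-first search.
module Component (G : Graph) (x y : Fin (n G)) where
  open Graphs G

  adjDel? : ∀ u v → Dec (AdjDel G x y u v)
  adjDel? u v = adj? u v ×-dec ¬? ((u ≟ᶠ x ×-dec v ≟ᶠ y) ⊎-dec (u ≟ᶠ y ×-dec v ≟ᶠ x))

  expand : Subset (n G) → Subset (n G)
  expand p = p ∪ select (λ v → any? (λ u → u ∈? p ×-dec adjDel? u v))

  expand-⊇ : ∀ p → p ⊆ expand p
  expand-⊇ p v∈p = x∈p∪q⁺ (inj₁ v∈p)

  expand-step : ∀ {p u v} → u ∈ p → AdjDel G x y u v → v ∈ expand p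
  expand-step {p} {u} u∈p uv = x∈p∪q⁺ (inj₂ (∈-select⁺ (λ v → any? (λ u → u ∈? p ×-dec adjDel? u v)) (u , u∈p , uv)))

  expand-cases : ∀ p {v} → v ∈ expand p → v ∈ p ⊎ ∃[ u ] (u ∈ p × AdjDel G x y u v)
  expand-cases p v∈ with x∈p∪q⁻ p _ v∈
  ... | inj₁ v∈p = inj₁ v∈p
  ... | inj₂ v∈N = inj₂ (∈-select⁻ (λ v → any? (λ u → u ∈? p ×-dec adjDel? u v)) v∈N)

  open Stationary expand expand-⊇

  layer : ℕ → Subset (n G)
  layer = iterate expand ⁅ x ⁆

  Tx : Subset (n G)
  Tx = layer (n G)

  x∈Tx : x ∈ Tx
  x∈Tx = iterate-⊆ ⁅ x ⁆ (n G) (x∈⁅x⁆ x)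

  Tx-closed : ∀ {u v} → u ∈ Tx → AdjDel G x y u v → v ∈ Tx
  Tx-closed u∈ uv = subst (_ ∈_) (stationary ⁅ x ⁆) (expand-step u∈ uv)

  Tx-complete : ∀ {v} → InTx G x y v → v ∈ Tx
  Tx-complete = reach x∈Tx
    where
    reach : ∀ {u v} → u ∈ Tx → Star (AdjDel G x y) u v → v ∈ Tx
    reach u∈ ε        = u∈
    reach u∈ (uw ◅ s) = reach (Tx-closed u∈ uw) s

  layer-sound : ∀ k {v} → v ∈ layer k → InTx G x y v
  layer-sound zero v∈ with x∈⁅y⁆⇒x≡y x v∈
  ... | refl = ε
  layer-sound (suc k) v∈ with expand-cases (layer k) v∈
  ... | inj₁ v∈k           = layer-sound k v∈k
  ... | inj₂ (u , u∈k , uv) = layer-sound k u∈k ◅◅ (uv ◅ ε)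

  BackPath : ℕ → V → Set
  BackPath k v = v ≡ x ⊎ Σ (List V) λ mid →
    Unique (v ∷ mid ++ [ x ]) × Linked (λ a b → AdjDel G x y b a) (v ∷ mid ++ [ x ])
    × All (_∈ layer k) (v ∷ mid ++ [ x ])

  -- A vertex first reached in layer k+1 extends a back path of a neighbour in
  -- layer k, which it does not meet.
  backPath : ∀ k {v} → v ∈ layer k → BackPath k v
  backPath zero v∈ with x∈⁅y⁆⇒x≡y x v∈
  ... | refl = inj₁ refl
  backPath (suc k) {v} v∈ with v ∈? layer k
  ... | yes v∈k = widen (backPath k v∈k)
    where
    widen : BackPath k v → BackPath (suc k) v
    widen (inj₁ v≡x) = inj₁ v≡x
    widen (inj₂ (mid , u , lk , in-layer)) = inj₂ (mid , u , lk , All.map (expand-⊇ _) in-layer)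
  ... | no v∉k with expand-cases (layer k) v∈
  ...   | inj₁ v∈k = ⊥-elim (v∉k v∈k)
  ...   | inj₂ (u , u∈k , uv) with backPath k u∈k
  ...     | inj₁ refl =
    inj₂ ([] , fresh∷ (λ { (here refl) → v∉k u∈k }) ([] ∷ []) , uv ∷ [-] , v∈ ∷ expand-⊇ _ u∈k ∷ [])
  ...     | inj₂ (mid , unique , linked , in-layer) =
    inj₂ (u ∷ mid , fresh∷ (λ v∈path → v∉k (All.lookup in-layer v∈path)) unique
                  , uv ∷ linked , v∈ ∷ All.map (expand-⊇ _) in-layer)

module Setting (G : Graph) (C : Cycle G) (unique : ∀ (D : Cycle G) → SameCycle C D)
               (x y : Fin (n G)) (x∉C : ¬ OnCycle C x) (y∈C : OnCycle C y) (xy : Adj G x y) where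
  open Graphs G
  open Cycles G
  open Unicyclic C unique
  open Forests G
  open KönigDecompositions G
  open KönigDecomposition
  open Component G x y

  -- Every cycle passes through y, so G - y is a forest.
  G-y-acyclic : Acyclic (⊤ - y)
  G-y-acyclic D on-G-y with onC⇒onD D y∈C
  ... | i , vi≡y = proj₂ (∈-remove⁻ (on-G-y i)) vi≡y

  -- T_x avoids y: a path from x to y in G - xy would close, with xy, a cycle through x.
  y∉Tx : ¬ InTx G x y y
  y∉Tx reach with backPath (n G) (Tx-complete reach)
  ... | inj₁ y≡x = x∉C (subst (OnCycle C) y≡x y∈C)
  ... | inj₂ ([] , _ , yx ∷ _ , _) = proj₂ yx (inj₁ (refl , refl))
  ... | inj₂ (m ∷ mid , unique′ , linked , _)
    with closeCycle y m mid x unique′ (Linked.map (λ e → Adj-sym (proj₁ e)) linked) xy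
  ...   | D , _ , on-D = x∉C (onD⇒onC D (on-D (there (there (∈-++⁺ʳ mid (here refl))))))

  Tx⊆G-y : Tx ⊆ ⊤ - y
  Tx⊆G-y {v} v∈ = x∈p∧x≢y⇒x∈p-y ∈⊤ (λ { refl → y∉Tx (layer-sound (n G) v∈) })

  -- Inside G - y the edge xy is absent, so adjacency there is adjacency in G - xy.
  adj-in-G-y : ∀ {u v} → u ∈ ⊤ - y → v ∈ ⊤ - y → Adj G u v → AdjDel G x y u v
  adj-in-G-y u∈ v∈ uv = uv , λ { (inj₁ (_ , refl)) → proj₂ (∈-remove⁻ v∈) refl
                               ; (inj₂ (refl , _)) → proj₂ (∈-remove⁻ u∈) refl }

  S∩Tx-maximum : (K : KönigDecomposition (⊤ - y)) → MaxIndependentTx G x y (S K ∩ Tx)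
  S∩Tx-maximum K = (in-Tx , independent-Tx) , maximum
    where
    in-Tx : ∀ v → v ∈ S K ∩ Tx → InTx G x y v
    in-Tx v v∈ = layer-sound (n G) (proj₂ (x∈p∩q⁻ (S K) Tx v∈))
    independent-Tx : ∀ u v → u ∈ S K ∩ Tx → v ∈ S K ∩ Tx → ¬ AdjDel G x y u v
    independent-Tx u v u∈ v∈ uv =
      independent K u v (proj₁ (x∈p∩q⁻ (S K) Tx u∈)) (proj₁ (x∈p∩q⁻ (S K) Tx v∈)) (proj₁ uv)
    maximum : ∀ Q → IndependentTx G x y Q → ∣ Q ∣ ≤ ∣ S K ∩ Tx ∣
    maximum Q (Q-in , Q-indep) =
      restriction-maximum K Tx⊆G-y (λ u∈ v∈ uv → Tx-closed u∈ (adj-in-G-y (Tx⊆G-y u∈) v∈ uv)) Q Q⊆Tx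
        (λ u v u∈ v∈ uv → Q-indep u v u∈ v∈ (adj-in-G-y (Tx⊆G-y (Q⊆Tx u∈)) (Tx⊆G-y (Q⊆Tx v∈)) uv))
      where
      Q⊆Tx : Q ⊆ Tx
      Q⊆Tx {v} v∈ = Tx-complete (Q-in v v∈)

  everything : ∀ v → v ∈ (⊤ - y) ∪ ⁅ y ⁆
  everything v with v ≟ᶠ y
  ... | yes refl = x∈p∪q⁺ (inj₂ (x∈⁅x⁆ y))
  ... | no  v≢y  = x∈p∪q⁺ (inj₁ (x∈p∧x≢y⇒x∈p-y ∈⊤ v≢y))

lemma2p8 : (G : Graph) (C : Cycle G) → UnicyclicWith G C →
           (∃[ x ] ∃[ y ] (¬ OnCycle C x × OnCycle C y × Adj G x y
                            × InCoreTx G x y x)) →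
           KonigEgervary G
lemma2p8 G C (_ , unique) (x , y , x∉C , y∈C , xy , x∈core) =
  spanning⇒KönigEgerváry (attachPendant K x∈S x-free y∉G-y xy) everything
  where
  open Setting G C unique x y x∉C y∈C xy
  open Forests G
  open KönigDecompositions G
  open KönigDecomposition
  open Component G x y
  decomposition : Σ (KönigDecomposition (⊤ - y)) (SourceFree x)
  decomposition = decompose x (⊂-wellFounded (⊤ - y)) G-y-acyclic
  K : KönigDecomposition (⊤ - y)
  K = proj₁ decomposition
  x-free : SourceFree x K
  x-free = proj₂ decomposition
  -- S ∩ T_x is a maximum independent set of T_x, hence contains its core
  x∈S : x ∈ S K
  x∈S = proj₁ (x∈p∩q⁻ (S K) Tx (x∈core (S K ∩ Tx) (S∩Tx-maximum K)))
  y∉G-y : y ∉ ⊤ - y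
  y∉G-y y∈ = proj₂ (∈-remove⁻ y∈) refl
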